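{- Let $n\ge3$ and let $m,k$ be integers with $2\le k+1\le m\le n-2$ or $3\le m+2\le k\le n-1$. Then $f$ maps $N\!T_n(m,k)$ onto $A_n(m+1,k)$ bijectively.
   Context: Andr\'e I permutations: words are permutations of finite sets $Y$ of positive integers; the empty word $e$ and one-letter words are Andr\'e I; for $|Y|\ge2$ write $w=v\,\min(w)\,v'$; $w$ is Andr\'e I if $v,v'$ are Andr\'e I and $\max(vv')$ is a letter of $v'$. $\mathrm{And}_n^{I}$: Andr\'e I permutations of $\{1,\dots,n\}$. For $w=x_1\cdots x_n$: $\mathbf{F}\,w=x_1$, $\mathbf{NL}\,w=x_{n-1}$. $A_n(m,k)=\{w\in\mathrm{And}_n^I:(\mathbf{F}\,w,\mathbf{NL}\,w)=(m,k)\}$. The map $f$: for a permutation $w$ of $\{1,\dots,n\}$ with first letter $m\le n-1$, written $w=m\,v\,(m+1)\,v'$, $f(w)=(m+1)\,v\,m\,v'$. Tight: $w=m\,v\,(m+1)\,v'\in\mathrm{And}_n^I$ (first letter $m$) is tight if (i) either $v=e$ or all letters of $v$ are less than $m$, and (ii) either $v'\ne e$ and the first letter of $v'$ is less than all letters of $w$ to its left, or $v'=e$ (and then $m=n-1$). $N\!T_n(m,k)$ is the set of elements of $A_n(m,k)$ that are not tight. -}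

module Defs where

open import Data.Nat using (ℕ; zero; suc; _≤_; _<_; _≡ᵇ_)
open import Data.Bool using (if_then_else_)
open import Data.List using (List; []; _∷_; _++_; map; upTo)
open import Data.List.Relation.Unary.All using (All)
open import Data.List.Membership.Propositional using (_∈_)
open import Data.List.Relation.Binary.Permutation.Propositional using (_↭_)
open import Data.Product using (Σ; ∃; ∃-syntax; _×_)
open import Data.Sum using (_⊎_)
open import Relation.Binary.PropositionalEquality using (_≡_)
open import Relation.Nullary using (¬_)

-- Words are lists of positive integers (letters distinct in all uses below,
-- since we only consider permutations of {1,…,n}).
Word : Set
Word = List ℕ

data AndreI : Word → Set where
  andre-e   : AndreI []
  andre-one : (x : ℕ) → AndreI (x ∷ [])
  andre-split : (v : Word) (x : ℕ) (v' : Word) →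
    All (x <_) (v ++ v') →
    AndreI v → AndreI v' →
    (∃[ y ] (y ∈ v' × All (_≤ y) (v ++ v'))) →
    AndreI (v ++ x ∷ v')

[1‥_] : ℕ → List ℕ
[1‥ n ] = map suc (upTo n)

IsPerm : ℕ → Word → Set
IsPerm n w = w ↭ [1‥ n ]

AndI : ℕ → Word → Set
AndI n w = IsPerm n w × AndreI w

-- first letter (default 0 on the empty word; irrelevant for n ≥ 3)
F : Word → ℕ
F []      = 0
F (x ∷ _) = x

-- next-to-last letter x_{n-1} (default 0 for words of length < 2)
NL : Word → ℕ
NL []               = 0
NL (x ∷ [])         = 0
NL (x ∷ y ∷ [])     = x
NL (x ∷ y ∷ z ∷ zs) = NL (y ∷ z ∷ zs)

A : ℕ → ℕ → ℕ → Word → Set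
A n m k w = AndI n w × F w ≡ m × NL w ≡ k

-- The map f: for w = m v (m+1) v' (a permutation, so m+1 occurs once after m),
-- f(w) = (m+1) v m v'.  Literally: change the first letter m to m+1 and the
-- (unique) later letter m+1 to m.
f : Word → Word
f []       = []
f (m ∷ xs) = suc m ∷ map (λ y → if y ≡ᵇ suc m then m else y) xs

Tight : Word → Set
Tight w = ∃[ m ] ∃[ v ] ∃[ v' ]
  ( w ≡ m ∷ v ++ suc m ∷ v'
  × All (_< m) v
  × ( v' ≡ []
    ⊎ ∃[ h ] ∃[ t ] (v' ≡ h ∷ t × All (h <_) (m ∷ v ++ suc m ∷ []))))

NT : ℕ → ℕ → ℕ → Word → Set
NT n m k w = A n m k w × ¬ Tight w

module Submission where

-- On a permutation w = m v (m+1) v' the map f is the letter transposition σ = (m m+1), an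
-- involution which, as k ∉ {m, m+1}, fixes the next-to-last letter. So it suffices that σ maps
-- NT_n(m,k) into A_n(m+1,k) and A_n(m+1,k) into NT_n(m,k).
-- σ is order preserving on every factor not containing both m and m+1, so the André I property
-- can only break in the factor of the recursive decomposition w = v · min(w) · v' that separates
-- m from m+1. Descending to that factor shows: an André I word starting with m+1 stays André I
-- under σ, and one starting with m stays André I unless it is tight. Conversely σ of a tight
-- word is never André I: for v' = h t the prefix (m+1) v m before the smaller letter h would be
-- André I and hence end in its maximum; and v' = e would bound every letter by m+1 < n.

open import Defs
open import Data.Nat using (ℕ; suc; _≤_; _<_; _∸_; _+_; z≤n; s≤s; s≤s⁻¹; _≟_; _≡ᵇ_)
open import Data.Nat.Properties
open import Data.Bool using (true; false; if_then_else_; T)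
open import Data.List using (List; []; _∷_; _++_; map)
open import Data.List.Properties using (map-++; ++-assoc; ++-conicalʳ; ∷-injective; ∷-injectiveˡ; ∷-injectiveʳ; map-id-local; map-cong-local)
open import Data.List.Relation.Unary.All as All using (All; []; _∷_)
import Data.List.Relation.Unary.All.Properties as All
open import Data.List.Relation.Unary.Any using (here; there)
open import Data.List.Membership.Propositional using (_∈_; _∉_)
open import Data.List.Membership.Propositional.Properties using (∈-map⁺; ∈-++⁺ˡ; ∈-++⁺ʳ; ∈-++⁻; ∈-∃++; ∈-upTo⁺)
open import Data.List.Relation.Binary.Permutation.Propositional using (_↭_; ↭-sym; ↭-trans; ↭-prep; ↭-swap; ↭-refl; ↭-reflexive; ↭⇒↭ₛ)
open import Data.List.Relation.Binary.Permutation.Propositional.Properties using (∈-resp-↭; shift)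
import Data.List.Relation.Binary.Permutation.Setoid.Properties as Perm
open import Data.List.Relation.Unary.Unique.Propositional using (Unique; []; _∷_) renaming (tail to Unique-tail)
import Data.List.Relation.Unary.Unique.Propositional.Properties as Unique
open import Data.Product using (∃-syntax; _×_; _,_)
open import Data.Sum using (_⊎_; inj₁; inj₂; fromInj₁)
import Data.Sum as Sum
open import Relation.Nullary using (¬_; yes; no)
open import Relation.Nullary.Negation using (contradiction)
open import Relation.Binary.PropositionalEquality using (_≡_; _≢_; ≢-sym; refl; sym; trans; cong; cong₂; subst; setoid; module ≡-Reasoning)
open import Function using (_∘′_)

if-T : ∀ {A : Set} {b} {x y : A} → T b → (if b then x else y) ≡ x
if-T {b = true} _ = refl

if-¬T : ∀ {A : Set} {b} {x y : A} → ¬ T b → (if b then x else y) ≡ y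
if-¬T {b = false} _  = refl
if-¬T {b = true}  ¬t = contradiction _ ¬t

∈-pivot : ∀ v {x : ℕ} {v'} → x ∈ v ++ x ∷ v'
∈-pivot v = ∈-++⁺ʳ v (here refl)

∈-right : ∀ {a : ℕ} v {x v'} → a ∈ v' → a ∈ v ++ x ∷ v'
∈-right v p = ∈-++⁺ʳ v (there p)

∈-skip : ∀ {a : ℕ} v {x v'} → a ∈ v ++ v' → a ∈ v ++ x ∷ v'
∈-skip v p with ∈-++⁻ v p
... | inj₁ q = ∈-++⁺ˡ q
... | inj₂ q = ∈-right v q

All-insert : ∀ {P : ℕ → Set} v {x v'} → All P (v ++ v') → P x → All P (v ++ x ∷ v')
All-insert v p px = All.++⁺ (All.++⁻ˡ v p) (px ∷ All.++⁻ʳ v p)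

Unique-++⁻ˡ : ∀ (xs : List ℕ) {ys} → Unique (xs ++ ys) → Unique xs
Unique-++⁻ˡ []       _        = []
Unique-++⁻ˡ (x ∷ xs) (x∉ ∷ u) = All.tabulate (λ p → All.lookup x∉ (∈-++⁺ˡ p)) ∷ Unique-++⁻ˡ xs u

Unique-++⁻ʳ : ∀ (xs : List ℕ) {ys} → Unique (xs ++ ys) → Unique ys
Unique-++⁻ʳ []       u       = u
Unique-++⁻ʳ (x ∷ xs) (_ ∷ u) = Unique-++⁻ʳ xs u

Unique-++⇒∉ : ∀ (xs : List ℕ) {ys a} → Unique (xs ++ ys) → a ∈ xs → a ∉ ys
Unique-++⇒∉ (x ∷ xs) (x≢ ∷ _) (here refl) q = All.lookup x≢ (∈-++⁺ʳ xs q) refl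
Unique-++⇒∉ (x ∷ xs) (_ ∷ u)  (there p)   q = Unique-++⇒∉ xs u p q

Unique-∉-middle : ∀ (β : List ℕ) {b γ} → Unique (β ++ b ∷ γ) → b ∉ β ++ γ
Unique-∉-middle β u b∈βγ with ∈-++⁻ β b∈βγ
... | inj₁ b∈β = Unique-++⇒∉ β u b∈β (here refl)
... | inj₂ b∈γ = Unique.Unique[x∷xs]⇒x∉xs (Unique-++⁻ʳ β u) b∈γ

↭-exchange : ∀ (a b : ℕ) β γ → b ∷ β ++ a ∷ γ ↭ a ∷ β ++ b ∷ γ
↭-exchange a b β γ = ↭-trans (↭-prep b (shift a β γ))
  (↭-trans (↭-swap b a ↭-refl) (↭-prep a (↭-sym (shift b β γ))))

transpose : ℕ → ℕ → ℕ
transpose m a with a ≟ m | a ≟ suc m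
... | yes _ | _     = suc m
... | no _  | yes _ = m
... | no _  | no _  = a

data TransposeView (m a : ℕ) : ℕ → Set where
  at-m      : a ≡ m     → TransposeView m a (suc m)
  at-suc-m  : a ≡ suc m → TransposeView m a m
  elsewhere : a ≢ m → a ≢ suc m → TransposeView m a a

transpose-view : ∀ m a → TransposeView m a (transpose m a)
transpose-view m a with a ≟ m | a ≟ suc m
... | yes p | _     = at-m p
... | no p  | yes q = at-suc-m q
... | no p  | no q  = elsewhere p q

module _ (m : ℕ) where

  private
    σ : ℕ → ℕ
    σ = transpose m

  transpose-m : σ m ≡ suc m
  transpose-m with σ m | transpose-view m m
  ... | _ | at-m _           = refl
  ... | _ | at-suc-m eq      = contradiction (sym eq) 1+n≢n
  ... | _ | elsewhere ≢m _   = contradiction refl ≢m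

  transpose-suc : σ (suc m) ≡ m
  transpose-suc with σ (suc m) | transpose-view m (suc m)
  ... | _ | at-m eq          = contradiction eq 1+n≢n
  ... | _ | at-suc-m _       = refl
  ... | _ | elsewhere _ ≢sm  = contradiction refl ≢sm

  transpose-fix : ∀ {a} → a ≢ m → a ≢ suc m → σ a ≡ a
  transpose-fix {a} ≢m ≢sm with σ a | transpose-view m a
  ... | _ | at-m eq          = contradiction eq ≢m
  ... | _ | at-suc-m eq      = contradiction eq ≢sm
  ... | _ | elsewhere _ _    = refl

  transpose-fix-< : ∀ {a} → a < m → σ a ≡ a
  transpose-fix-< a<m = transpose-fix (<⇒≢ a<m) (<⇒≢ (m<n⇒m<1+n a<m))

  transpose-fix-> : ∀ {a} → suc m < a → σ a ≡ a
  transpose-fix-> sm<a = transpose-fix (>⇒≢ (<-trans (n<1+n m) sm<a)) (>⇒≢ sm<a)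

  transpose-involutive : ∀ a → σ (σ a) ≡ a
  transpose-involutive a with σ a | transpose-view m a
  ... | _ | at-m refl         = transpose-suc
  ... | _ | at-suc-m refl     = transpose-m
  ... | _ | elsewhere ≢m ≢sm  = transpose-fix ≢m ≢sm

  transpose-< : ∀ {a b} → a < b → ¬ (a ≡ m × b ≡ suc m) → σ a < σ b
  transpose-< {a} {b} a<b not-pair with σ a | transpose-view m a | σ b | transpose-view m b
  ... | _ | at-m refl      | _ | at-m refl       = contradiction a<b (<-irrefl refl)
  ... | _ | at-m refl      | _ | at-suc-m refl   = contradiction (refl , refl) not-pair
  ... | _ | at-m refl      | _ | elsewhere _ ≢sm = ≤∧≢⇒< a<b (≢-sym ≢sm)
  ... | _ | at-suc-m refl  | _ | at-m refl       = contradiction a<b (<-asym (n<1+n m))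
  ... | _ | at-suc-m refl  | _ | at-suc-m refl   = contradiction a<b (<-irrefl refl)
  ... | _ | at-suc-m refl  | _ | elsewhere _ _   = <-trans (n<1+n m) a<b
  ... | _ | elsewhere _ _  | _ | at-m refl       = m<n⇒m<1+n a<b
  ... | _ | elsewhere ≢m _ | _ | at-suc-m refl   = ≤∧≢⇒< (s≤s⁻¹ a<b) ≢m
  ... | _ | elsewhere _ _  | _ | elsewhere _ _   = a<b

  transpose-≤ : ∀ {a b} → a ≤ b → ¬ (a ≡ m × b ≡ suc m) → σ a ≤ σ b
  transpose-≤ a≤b not-pair with m≤n⇒m<n∨m≡n a≤b
  ... | inj₁ a<b  = <⇒≤ (transpose-< a<b not-pair)
  ... | inj₂ refl = ≤-refl

StrictMonoOn : (ℕ → ℕ) → List ℕ → Set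
StrictMonoOn h xs = ∀ {a b} → a ∈ xs → b ∈ xs → a < b → h a < h b

StrictMonoOn⇒≤ : ∀ {h xs a b} → StrictMonoOn h xs → a ∈ xs → b ∈ xs → a ≤ b → h a ≤ h b
StrictMonoOn⇒≤ mono a∈ b∈ a≤b with m≤n⇒m<n∨m≡n a≤b
... | inj₁ a<b  = <⇒≤ (mono a∈ b∈ a<b)
... | inj₂ refl = ≤-refl

transpose-strictMonoOn : ∀ m {xs} → m ∉ xs ⊎ suc m ∉ xs → StrictMonoOn (transpose m) xs
transpose-strictMonoOn m (inj₁ m∉)  a∈ b∈ a<b = transpose-< m a<b (λ { (refl , _) → m∉ a∈ })
transpose-strictMonoOn m (inj₂ sm∉) a∈ b∈ a<b = transpose-< m a<b (λ { (_ , refl) → sm∉ b∈ })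

AndreI-map : ∀ {h w} → StrictMonoOn h w → AndreI w → AndreI (map h w)
AndreI-map mono andre-e = andre-e
AndreI-map {h} mono (andre-one x) = andre-one (h x)
AndreI-map {h} mono (andre-split v x v' x<vv' dv dv' (y , y∈v' , vv'≤y)) =
  subst AndreI (sym (map-++ h v (x ∷ v')))
    (andre-split (map h v) (h x) (map h v')
      (subst (All (h x <_)) (map-++ h v v')
        (All.map⁺ (All.tabulate λ p → mono (∈-pivot v) (∈-skip v p) (All.lookup x<vv' p))))
      (AndreI-map (λ p q → mono (∈-++⁺ˡ p) (∈-++⁺ˡ q)) dv)
      (AndreI-map (λ p q → mono (∈-right v p) (∈-right v q)) dv')
      (h y , ∈-map⁺ h y∈v' ,
       subst (All (_≤ h y)) (map-++ h v v')
         (All.map⁺ (All.tabulate λ p →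
           StrictMonoOn⇒≤ mono (∈-skip v p) (∈-right v y∈v') (All.lookup vv'≤y p)))))

last₀ : Word → ℕ
last₀ []          = 0
last₀ (x ∷ [])    = x
last₀ (_ ∷ y ∷ w) = last₀ (y ∷ w)

last₀-++ : ∀ v (x : ℕ) w → last₀ (v ++ x ∷ w) ≡ last₀ (x ∷ w)
last₀-++ []          x w = refl
last₀-++ (a ∷ [])    x w = refl
last₀-++ (a ∷ b ∷ v) x w = last₀-++ (b ∷ v) x w

last₀-∈ : ∀ (x : ℕ) w → last₀ (x ∷ w) ∈ x ∷ w
last₀-∈ x []      = here refl
last₀-∈ x (y ∷ w) = there (last₀-∈ y w)

AndreI-≤-last : ∀ {w} → AndreI w → ∀ {a} → a ∈ w → a ≤ last₀ w
AndreI-≤-last (andre-one x) (here refl) = ≤-refl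
AndreI-≤-last (andre-split v x [] _ _ _ (_ , () , _))
AndreI-≤-last (andre-split v x (c ∷ v') x<vv' _ dv' (y , y∈v' , vv'≤y)) {a} a∈
  rewrite last₀-++ v x (c ∷ v') with ∈-++⁻ v a∈
... | inj₁ a∈v          = ≤-trans (All.lookup vv'≤y (∈-++⁺ˡ a∈v)) (AndreI-≤-last dv' y∈v')
... | inj₂ (here refl)  = <⇒≤ (<-≤-trans (All.lookup x<vv' (∈-++⁺ʳ v y∈v')) (AndreI-≤-last dv' y∈v'))
... | inj₂ (there a∈v') = AndreI-≤-last dv' a∈v'

AndreI-max-at-end : ∀ {w a} → AndreI w → Unique w → a ∈ w → All (_≤ a) w →
  ∃[ β ] (w ≡ β ++ a ∷ [])
AndreI-max-at-end {a = a} dw uw a∈w w≤a with ∈-∃++ a∈w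
... | β , []    , refl = β , refl
... | β , c ∷ γ , refl = contradiction (subst (_∈ c ∷ γ) last≡a (last₀-∈ c γ)) a∉cγ
  where
  a∉cγ : a ∉ c ∷ γ
  a∉cγ = Unique.Unique[x∷xs]⇒x∉xs (Unique-++⁻ʳ β uw)
  a≤last : a ≤ last₀ (c ∷ γ)
  a≤last = subst (a ≤_) (last₀-++ β a (c ∷ γ)) (AndreI-≤-last dw a∈w)
  last≡a : last₀ (c ∷ γ) ≡ a
  last≡a = ≤-antisym (All.lookup w≤a (∈-right β (last₀-∈ c γ))) a≤last

AndreI-cons-min : ∀ {z β} → All (z <_) β → AndreI β → AndreI (z ∷ β)
AndreI-cons-min {z} {[]}    _   _  = andre-one z
AndreI-cons-min {z} {b ∷ β} z<β dβ =
  andre-split [] z (b ∷ β) z<β andre-e dβ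
    (last₀ (b ∷ β) , last₀-∈ b β , All.tabulate (AndreI-≤-last dβ))

AndreI-uncons-min : ∀ {z β} → AndreI (z ∷ β) → All (z <_) β → AndreI β
AndreI-uncons-min d = go d refl
  where
  go : ∀ {w z β} → AndreI w → w ≡ z ∷ β → All (z <_) β → AndreI β
  go (andre-one _)                         refl _   = andre-e
  go (andre-split []      _ _ _ _ dβ _)    refl _   = dβ
  go (andre-split (a ∷ v) x _ x<vv' _ _ _) refl z<β =
    contradiction (All.lookup x<vv' (here refl)) (<-asym (All.lookup z<β (∈-pivot v)))

++-∷-cases : ∀ (v : Word) x v' P h t → v ++ x ∷ v' ≡ P ++ h ∷ t →
  v ≡ P ⊎ (∃[ s ] (P ≡ v ++ x ∷ s × v' ≡ s ++ h ∷ t)) ⊎ (∃[ s ] (v ≡ P ++ h ∷ s))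
++-∷-cases []      x v' []      h t eq   = inj₁ refl
++-∷-cases []      x v' (p ∷ P) h t refl = inj₂ (inj₁ (P , refl , refl))
++-∷-cases (a ∷ v) x v' []      h t refl = inj₂ (inj₂ (v , refl))
++-∷-cases (a ∷ v) x v' (p ∷ P) h t eq with ∷-injective eq
... | refl , eq' with ++-∷-cases v x v' P h t eq'
...   | inj₁ refl                     = inj₁ refl
...   | inj₂ (inj₁ (s , refl , refl)) = inj₂ (inj₁ (s , refl , refl))
...   | inj₂ (inj₂ (s , refl))        = inj₂ (inj₂ (s , refl))

AndreI-prefix : ∀ P {h t} → AndreI (P ++ h ∷ t) → All (h <_) P → AndreI P
AndreI-prefix P d = go P d refl
  where
  go : ∀ {w} P {h t} → AndreI w → w ≡ P ++ h ∷ t → All (h <_) P → AndreI P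
  go []      _ _ _ = andre-e
  go P {h} {t} andre-e eq _ = contradiction (++-conicalʳ P (h ∷ t) (sym eq)) λ ()
  go (p ∷ P) {h} {t} (andre-one x) eq _ =
    contradiction (++-conicalʳ P (h ∷ t) (sym (∷-injectiveʳ eq))) λ ()
  go P {h} {t} (andre-split v x v' x<vv' dv _ _) eq h<P
    with ++-∷-cases v x v' P h t eq
  ... | inj₁ refl = dv
  ... | inj₂ (inj₁ (s , refl , refl)) =
    contradiction (All.lookup x<vv' (∈-++⁺ʳ v (∈-pivot s))) (<-asym (All.lookup h<P (∈-pivot v)))
  ... | inj₂ (inj₂ (s , refl)) = go P dv refl h<P

TightAt : ℕ → Word → Set
TightAt m w = ∃[ v ] ∃[ v' ]
  ( w ≡ m ∷ v ++ suc m ∷ v'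
  × All (_< m) v
  × ( v' ≡ []
    ⊎ ∃[ h ] ∃[ t ] (v' ≡ h ∷ t × All (h <_) (m ∷ v ++ suc m ∷ []))))

module _ (m : ℕ) where

  private
    σ : ℕ → ℕ
    σ = transpose m

  map-transpose-fix : ∀ {xs} → m ∉ xs → suc m ∉ xs → map σ xs ≡ xs
  map-transpose-fix m∉xs sm∉xs = map-id-local (All.tabulate λ c∈xs →
    transpose-fix m (λ { refl → m∉xs c∈xs }) (λ { refl → sm∉xs c∈xs }))

  map-transpose-fix-< : ∀ {xs} → All (_< m) xs → map σ xs ≡ xs
  map-transpose-fix-< xs<m = map-id-local (All.map (transpose-fix-< m) xs<m)

  map-transpose-fix-> : ∀ {xs} → All (suc m <_) xs → map σ xs ≡ xs
  map-transpose-fix-> sm<xs = map-id-local (All.map (transpose-fix-> m) sm<xs)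

  map-transpose-around : ∀ v {a} v' → All (suc m <_) (v ++ v') →
    map σ (v ++ a ∷ v') ≡ v ++ σ a ∷ v'
  map-transpose-around v {a} v' sm<vv' = trans (map-++ σ v (a ∷ v'))
    (cong₂ _++_ (map-transpose-fix-> (All.++⁻ˡ v sm<vv'))
                (cong (σ a ∷_) (map-transpose-fix-> (All.++⁻ʳ v sm<vv'))))

  map-transpose-involutive : ∀ w → map σ (map σ w) ≡ w
  map-transpose-involutive []      = refl
  map-transpose-involutive (a ∷ w) = cong₂ _∷_ (transpose-involutive m a) (map-transpose-involutive w)

  map-transpose-injective : ∀ {w₁ w₂} → map σ w₁ ≡ map σ w₂ → w₁ ≡ w₂
  map-transpose-injective {w₁} {w₂} σw₁≡σw₂ = begin
    w₁               ≡⟨ sym (map-transpose-involutive w₁) ⟩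
    map σ (map σ w₁) ≡⟨ cong (map σ) σw₁≡σw₂ ⟩
    map σ (map σ w₂) ≡⟨ map-transpose-involutive w₂ ⟩
    w₂               ∎
    where open ≡-Reasoning

  map-transpose-exchange-↭ : ∀ {a b} β γ → σ a ≡ b → σ b ≡ a → m ∉ β ++ γ → suc m ∉ β ++ γ →
    map σ (a ∷ β ++ b ∷ γ) ↭ a ∷ β ++ b ∷ γ
  map-transpose-exchange-↭ {a} {b} β γ σa≡b σb≡a m∉βγ sm∉βγ =
    ↭-trans (↭-reflexive σw≡) (↭-exchange a b β γ)
    where
    σw≡ : map σ (a ∷ β ++ b ∷ γ) ≡ b ∷ β ++ a ∷ γ
    σw≡ = cong₂ _∷_ σa≡b (trans (map-++ σ β (b ∷ γ))
      (cong₂ _++_ (map-transpose-fix (m∉βγ ∘′ ∈-++⁺ˡ) (sm∉βγ ∘′ ∈-++⁺ˡ))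
                  (cong₂ _∷_ σb≡a (map-transpose-fix (m∉βγ ∘′ ∈-++⁺ʳ β) (sm∉βγ ∘′ ∈-++⁺ʳ β)))))

  map-transpose-↭ : ∀ {w} → Unique w → m ∈ w → suc m ∈ w → map σ w ↭ w
  map-transpose-↭ _ (here refl) (here sm≡m) = contradiction sm≡m 1+n≢n
  map-transpose-↭ (m∉r ∷ ur) (here refl) (there sm∈r) with ∈-∃++ sm∈r
  ... | β , γ , refl = map-transpose-exchange-↭ β γ (transpose-m m) (transpose-suc m)
                         (λ m∈βγ → All.lookup m∉r (∈-skip β m∈βγ) refl) (Unique-∉-middle β ur)
  map-transpose-↭ (sm∉r ∷ ur) (there m∈r) (here refl) with ∈-∃++ m∈r
  ... | β , γ , refl = map-transpose-exchange-↭ β γ (transpose-suc m) (transpose-m m)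
                         (Unique-∉-middle β ur) (λ sm∈βγ → All.lookup sm∉r (∈-skip β sm∈βγ) refl)
  map-transpose-↭ {a ∷ r} (a∉r ∷ ur) (there m∈r) (there sm∈r) =
    subst (λ c → c ∷ map σ r ↭ a ∷ r)
          (sym (transpose-fix m (λ { refl → All.lookup a∉r m∈r refl })
                                (λ { refl → All.lookup a∉r sm∈r refl })))
          (↭-prep a (map-transpose-↭ ur m∈r sm∈r))

  AndreI-transpose : ∀ {w} → m ∉ w ⊎ suc m ∉ w → AndreI w → AndreI (map σ w)
  AndreI-transpose avoids = AndreI-map (transpose-strictMonoOn m avoids)

  AndreI-transpose-split : ∀ v {x} v' {y} → x < m → All (x <_) (v ++ v') →
    y ∈ v' → All (_≤ y) (v ++ v') → suc m < y →
    AndreI (map σ v) → AndreI (map σ v') → AndreI (map σ (v ++ x ∷ v'))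
  AndreI-transpose-split v {x} v' {y} x<m x<vv' y∈v' vv'≤y sm<y dσv dσv' =
    subst AndreI (sym σw≡) (andre-split (map σ v) x (map σ v') x<σvv' dσv dσv' (y , y∈σv' , σvv'≤y))
    where
    σx≡x : σ x ≡ x
    σx≡x = transpose-fix-< m x<m
    σy≡y : σ y ≡ y
    σy≡y = transpose-fix-> m sm<y
    σw≡ : map σ (v ++ x ∷ v') ≡ map σ v ++ x ∷ map σ v'
    σw≡ = trans (map-++ σ v (x ∷ v')) (cong (λ a → map σ v ++ a ∷ map σ v') σx≡x)
    x<σvv' : All (x <_) (map σ v ++ map σ v')
    x<σvv' = subst (All (x <_)) (map-++ σ v v') (All.map⁺ (All.map
      (λ {a} x<a → subst (_< σ a) σx≡x (transpose-< m x<a λ (x≡m , _) → <⇒≢ x<m x≡m))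
      x<vv'))
    σvv'≤y : All (_≤ y) (map σ v ++ map σ v')
    σvv'≤y = subst (All (_≤ y)) (map-++ σ v v') (All.map⁺ (All.map
      (λ {a} a≤y → subst (σ a ≤_) σy≡y (transpose-≤ m a≤y λ (_ , y≡sm) → >⇒≢ sm<y y≡sm))
      vv'≤y))
    y∈σv' : y ∈ map σ v'
    y∈σv' = subst (_∈ map σ v') σy≡y (∈-map⁺ σ y∈v')

  AndreI-transpose-∷-min : ∀ {v'} → AndreI v' → All (m <_) v' → suc m ∈ v' →
    AndreI (map σ (m ∷ v')) ⊎ v' ≡ suc m ∷ []
  AndreI-transpose-∷-min (andre-one _) _ (here refl) = inj₂ refl
  AndreI-transpose-∷-min (andre-split β z γ z<βγ dβ dγ (y , y∈γ , βγ≤y)) m<βzγ sm∈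
    with ≤-antisym (All.lookup (All-insert β (All.map <⇒≤ z<βγ) ≤-refl) sm∈)
                   (All.lookup m<βzγ (∈-pivot β))
  ... | refl = inj₁ (subst AndreI (sym σw≡)
    (andre-split (suc m ∷ β) m γ (n<1+n m ∷ All.map (<-trans (n<1+n m)) z<βγ)
      (AndreI-cons-min (All.++⁻ˡ β z<βγ) dβ) dγ
      (y , y∈γ , <⇒≤ (All.lookup z<βγ (∈-++⁺ʳ β y∈γ)) ∷ βγ≤y)))
    where
    σw≡ : map σ (m ∷ β ++ suc m ∷ γ) ≡ (suc m ∷ β) ++ m ∷ γ
    σw≡ = cong₂ _∷_ (transpose-m m)
      (trans (map-transpose-around β γ z<βγ) (cong (λ a → β ++ a ∷ γ) (transpose-suc m)))

  AndreI-transpose-pivot : ∀ v v' {y} → AndreI (suc m ∷ v) → AndreI v' → All (suc m <_) (v ++ v') →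
    y ∈ v' → All (_≤ y) (suc m ∷ v ++ v') → AndreI (map σ ((suc m ∷ v) ++ m ∷ v'))
  AndreI-transpose-pivot v v' {y} dsmv dv' sm<vv' y∈v' (sm≤y ∷ vv'≤y) =
    subst AndreI (sym σw≡)
      (andre-split [] m (v ++ suc m ∷ v') (All-insert v (All.map (<-trans (n<1+n m)) sm<vv') (n<1+n m))
        andre-e
        (andre-split v (suc m) v' sm<vv' (AndreI-uncons-min dsmv (All.++⁻ˡ v sm<vv')) dv' (y , y∈v' , vv'≤y))
        (y , ∈-right v y∈v' , All-insert v vv'≤y sm≤y))
    where
    σw≡ : map σ ((suc m ∷ v) ++ m ∷ v') ≡ m ∷ v ++ suc m ∷ v'
    σw≡ = cong₂ _∷_ (transpose-suc m)
      (trans (map-transpose-around v v' sm<vv') (cong (λ a → v ++ a ∷ v') (transpose-m m)))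

  TightAt-++ : ∀ {w} x w' → TightAt m w → All (x <_) w → TightAt m (w ++ x ∷ w')
  TightAt-++ x w' (p , q , refl , p<m , inj₁ refl) x<w =
    p , x ∷ w' , cong (m ∷_) (++-assoc p (suc m ∷ []) (x ∷ w')) , p<m , inj₂ (x , w' , refl , x<w)
  TightAt-++ x w' (p , q , refl , p<m , inj₂ (h , t , refl , h<)) _ =
    p , h ∷ t ++ x ∷ w' , cong (m ∷_) (++-assoc p (suc m ∷ h ∷ t) (x ∷ w')) , p<m ,
    inj₂ (h , t ++ x ∷ w' , refl , h<)

  TightAt-bounded : ∀ {w} p → w ≡ m ∷ p ++ suc m ∷ [] → Unique w → All (_≤ suc m) w → TightAt m w
  TightAt-bounded p refl (m∉ ∷ u) (_ ∷ w≤sm) = p , [] , refl , All.tabulate p<m , inj₁ refl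
    where
    p<sm : ∀ {c} → c ∈ p → c < suc m
    p<sm c∈p = ≤∧≢⇒< (All.lookup w≤sm (∈-++⁺ˡ c∈p)) λ c≡sm → Unique-++⇒∉ p u c∈p (here c≡sm)
    p<m : ∀ {c} → c ∈ p → c < m
    p<m c∈p = ≤∧≢⇒< (m<1+n⇒m≤n (p<sm c∈p)) (≢-sym (All.lookup m∉ (∈-++⁺ˡ c∈p)))

  TightAt⇒bounded⊎¬AndreI-transpose : ∀ {w} → TightAt m w → All (_≤ suc m) w ⊎ ¬ AndreI (map σ w)
  TightAt⇒bounded⊎¬AndreI-transpose (p , _ , refl , p<m , inj₁ refl) =
    inj₁ (n≤1+n m ∷ All.++⁺ (All.map (<⇒≤ ∘′ m<n⇒m<1+n) p<m) (≤-refl ∷ []))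
  TightAt⇒bounded⊎¬AndreI-transpose (p , _ , refl , p<m , inj₂ (h , t , refl , h<mpsm)) =
    inj₂ λ dσw → 1+n≰n (subst (suc m ≤_) (last₀-++ (suc m ∷ p) m [])
      (AndreI-≤-last (AndreI-prefix (suc m ∷ p ++ m ∷ []) (subst AndreI σw≡ dσw) h<smpm) (here refl)))
    where
    open ≡-Reasoning
    h<m : h < m
    h<m = All.lookup h<mpsm (here refl)
    h<smpm : All (h <_) (suc m ∷ p ++ m ∷ [])
    h<smpm = All.lookup h<mpsm (there (∈-pivot p)) ∷ All.++⁺ (All.++⁻ˡ p (All.tail h<mpsm)) (h<m ∷ [])
    σw≡ : map σ (m ∷ p ++ suc m ∷ h ∷ t) ≡ (suc m ∷ p ++ m ∷ []) ++ h ∷ map σ t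
    σw≡ = begin
      σ m ∷ map σ (p ++ suc m ∷ h ∷ t)
        ≡⟨ cong₂ _∷_ (transpose-m m) (map-++ σ p (suc m ∷ h ∷ t)) ⟩
      suc m ∷ map σ p ++ σ (suc m) ∷ σ h ∷ map σ t
        ≡⟨ cong (suc m ∷_) (cong₂ _++_ (map-transpose-fix-< p<m)
             (cong₂ (λ a b → a ∷ b ∷ map σ t) (transpose-suc m) (transpose-fix-< m h<m))) ⟩
      suc m ∷ p ++ m ∷ h ∷ map σ t
        ≡⟨ cong (suc m ∷_) (sym (++-assoc p (m ∷ []) (h ∷ map σ t))) ⟩
      (suc m ∷ p ++ m ∷ []) ++ h ∷ map σ t
        ∎

  AndreI-transpose⊎TightAt : ∀ {u} → AndreI u → F u ≡ m → suc m ∈ u → Unique u →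
    AndreI (map σ u) ⊎ TightAt m u
  AndreI-transpose⊎TightAt (andre-one _) refl (here sm≡m) _ = contradiction sm≡m 1+n≢n
  AndreI-transpose⊎TightAt (andre-split [] _ _ _ _ _ _) refl (here sm≡m) _ = contradiction sm≡m 1+n≢n
  AndreI-transpose⊎TightAt (andre-split [] _ v' m<v' _ dv' _) refl (there sm∈v') _ =
    Sum.map₂ (λ { refl → [] , [] , refl , [] , inj₁ refl }) (AndreI-transpose-∷-min dv' m<v' sm∈v')
  AndreI-transpose⊎TightAt
    (andre-split (m ∷ v) x v' x<vv'@(x<m ∷ _) dv dv' (y , y∈v' , vv'≤y)) refl sm∈u u
    with ∈-++⁻ (m ∷ v) sm∈u
  ... | inj₂ (here refl) = contradiction x<m (<-asym (n<1+n m))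
  ... | inj₁ sm∈mv =
    Sum.map (λ dσv → AndreI-transpose-split (m ∷ v) v' x<m x<vv' y∈v' vv'≤y sm<y dσv
                       (AndreI-transpose (inj₁ m∉v') dv'))
            (λ tight → TightAt-++ x v' tight (All.++⁻ˡ (m ∷ v) x<vv'))
            (AndreI-transpose⊎TightAt dv refl sm∈mv (Unique-++⁻ˡ (m ∷ v) u))
    where
    m∉v' : m ∉ v'
    m∉v' = Unique-++⇒∉ (m ∷ v) u (here refl) ∘′ there
    sm<y : suc m < y
    sm<y = ≤∧≢⇒< (All.lookup vv'≤y (∈-++⁺ˡ sm∈mv))
                 λ { refl → Unique-++⇒∉ (m ∷ v) u sm∈mv (there y∈v') }
  ... | inj₂ (there sm∈v') with y ≟ suc m
  ...   | no y≢sm =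
    inj₁ (AndreI-transpose-split (m ∷ v) v' x<m x<vv' y∈v' vv'≤y
           (≤∧≢⇒< (All.lookup vv'≤y (∈-++⁺ʳ (m ∷ v) sm∈v')) (≢-sym y≢sm))
           (AndreI-transpose (inj₂ λ sm∈mv → Unique-++⇒∉ (m ∷ v) u sm∈mv (there sm∈v')) dv)
           (AndreI-transpose (inj₁ (Unique-++⇒∉ (m ∷ v) u (here refl) ∘′ there)) dv'))
  ...   | yes refl with AndreI-max-at-end dv' (Unique-tail (Unique-++⁻ʳ (m ∷ v) u)) sm∈v'
                                          (All.++⁻ʳ (m ∷ v) vv'≤y)
  ...     | β , refl =
    inj₂ (TightAt-bounded (v ++ x ∷ β) (cong (m ∷_) (sym (++-assoc v (x ∷ β) (suc m ∷ [])))) u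
           (All-insert (m ∷ v) vv'≤y (<⇒≤ (m<n⇒m<1+n x<m))))

  AndreI-transpose-F≡suc : ∀ {u} → AndreI u → F u ≡ suc m → m ∈ u → Unique u → AndreI (map σ u)
  AndreI-transpose-F≡suc (andre-one _) refl (here m≡sm) _ = contradiction (sym m≡sm) 1+n≢n
  AndreI-transpose-F≡suc (andre-split [] _ _ _ _ _ _) refl (here m≡sm) _ = contradiction (sym m≡sm) 1+n≢n
  AndreI-transpose-F≡suc (andre-split [] _ _ sm<v' _ _ _) refl (there m∈v') _ =
    contradiction (All.lookup sm<v' m∈v') (<-asym (n<1+n m))
  AndreI-transpose-F≡suc
    (andre-split (suc m ∷ v) x v' x<vv'@(x<sm ∷ m<vv') dv dv' (y , y∈v' , vv'≤y@(sm≤y ∷ _))) refl m∈u u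
    with ∈-++⁻ (suc m ∷ v) m∈u
  ... | inj₂ (here refl) = AndreI-transpose-pivot v v' dv dv' sm<vv' y∈v' vv'≤y
    where
    sm<vv' : All (suc m <_) (v ++ v')
    sm<vv' = All.tabulate λ c∈ →
      ≤∧≢⇒< (All.lookup m<vv' c∈) λ { refl → Unique.Unique[x∷xs]⇒x∉xs u (∈-skip v c∈) }
  ... | inj₁ m∈smv =
    AndreI-transpose-split (suc m ∷ v) v' x<m x<vv' y∈v' vv'≤y sm<y
      (AndreI-transpose-F≡suc dv refl m∈smv (Unique-++⁻ˡ (suc m ∷ v) u))
      (AndreI-transpose (inj₁ (Unique-++⇒∉ (suc m ∷ v) u m∈smv ∘′ there)) dv')
    where
    x<m : x < m
    x<m = ≤∧≢⇒< (m<1+n⇒m≤n x<sm) λ { refl → Unique-++⇒∉ (suc m ∷ v) u m∈smv (here refl) }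
    sm<y : suc m < y
    sm<y = ≤∧≢⇒< sm≤y λ { refl → Unique-++⇒∉ (suc m ∷ v) u (here refl) (there y∈v') }
  ... | inj₂ (there m∈v') =
    AndreI-transpose-split (suc m ∷ v) v' x<m x<vv' y∈v' vv'≤y sm<y
      (AndreI-transpose (inj₁ λ m∈smv → Unique-++⇒∉ (suc m ∷ v) u m∈smv (there m∈v')) dv)
      (AndreI-transpose (inj₂ (Unique-++⇒∉ (suc m ∷ v) u (here refl) ∘′ there)) dv')
    where
    x<m : x < m
    x<m = ≤∧≢⇒< (m<1+n⇒m≤n x<sm)
                λ { refl → Unique.Unique[x∷xs]⇒x∉xs (Unique-++⁻ʳ (suc m ∷ v) u) m∈v' }
    sm<y : suc m < y
    sm<y = ≤∧≢⇒< sm≤y λ { refl → Unique-++⇒∉ (suc m ∷ v) u (here refl) (there y∈v') }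

IsPerm⇒Unique : ∀ {n w} → IsPerm n w → Unique w
IsPerm⇒Unique {n} w↭ =
  Perm.Unique-resp-↭ (setoid ℕ) (↭⇒↭ₛ (↭-sym w↭)) (Unique.map⁺ suc-injective (Unique.upTo⁺ n))

IsPerm⇒∈ : ∀ {n w a} → IsPerm n w → 1 ≤ a → a ≤ n → a ∈ w
IsPerm⇒∈ {a = suc i} w↭ _ i<n = ∈-resp-↭ (↭-sym w↭) (∈-map⁺ suc (∈-upTo⁺ i<n))

f-transpose : ∀ m r → m ∉ r → f (m ∷ r) ≡ map (transpose m) (m ∷ r)
f-transpose m r m∉r = cong₂ _∷_ (sym (transpose-m m))
  (map-cong-local (All.tabulate λ {a} a∈r → relabel a λ { refl → m∉r a∈r }))
  where
  relabel : ∀ a → a ≢ m → (if a ≡ᵇ suc m then m else a) ≡ transpose m a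
  relabel a a≢m with transpose m a | transpose-view m a
  ... | _ | at-m a≡m         = contradiction a≡m a≢m
  ... | _ | at-suc-m refl    = if-T (≡⇒≡ᵇ (suc m) (suc m) refl)
  ... | _ | elsewhere _ a≢sm = if-¬T (a≢sm ∘′ ≡ᵇ⇒≡ a (suc m))

NT⇒f≡transpose : ∀ {n m k w} → NT n m k w → f w ≡ map (transpose m) w
NT⇒f≡transpose {w = []}    _ = refl
NT⇒f≡transpose {w = _ ∷ r} (((w↭ , _) , refl , _) , _) =
  f-transpose _ r (Unique.Unique[x∷xs]⇒x∉xs (IsPerm⇒Unique w↭))

NL-map : ∀ (h : ℕ → ℕ) w → h 0 ≡ 0 → NL (map h w) ≡ h (NL w)
NL-map h []              h0≡0 = sym h0≡0
NL-map h (_ ∷ [])        h0≡0 = sym h0≡0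
NL-map h (_ ∷ _ ∷ [])    _    = refl
NL-map h (_ ∷ y ∷ z ∷ w) h0≡0 = NL-map h (y ∷ z ∷ w) h0≡0

record Admissible (n m k : ℕ) : Set where
  field
    0<m   : 0 < m
    m+2≤n : suc (suc m) ≤ n
    k≢m   : k ≢ m
    k≢m+1 : k ≢ suc m

admissible : ∀ n m k → 3 ≤ n →
  (2 ≤ k + 1 × k + 1 ≤ m × m ≤ n ∸ 2) ⊎ (3 ≤ m + 2 × m + 2 ≤ k × k ≤ n ∸ 1) → Admissible n m k
admissible n m k 3≤n (inj₁ (2≤k+1 , k+1≤m , m≤n-2)) = record
  { 0<m   = ≤-trans (s≤s⁻¹ (subst (2 ≤_) (+-comm k 1) 2≤k+1)) (<⇒≤ k<m)
  ; m+2≤n = subst (_≤ n) (+-comm m 2) (m≤o∸n⇒m+n≤o m (≤-trans (n≤1+n 2) 3≤n) m≤n-2)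
  ; k≢m   = <⇒≢ k<m
  ; k≢m+1 = <⇒≢ (m<n⇒m<1+n k<m)
  }
  where
  k<m : k < m
  k<m = subst (_≤ m) (+-comm k 1) k+1≤m
admissible n m k 3≤n (inj₂ (3≤m+2 , m+2≤k , k≤n-1)) = record
  { 0<m   = s≤s⁻¹ (s≤s⁻¹ (subst (3 ≤_) (+-comm m 2) 3≤m+2))
  ; m+2≤n = ≤-trans m+1<k (<⇒≤ k<n)
  ; k≢m   = >⇒≢ (<-trans (n<1+n m) m+1<k)
  ; k≢m+1 = >⇒≢ m+1<k
  }
  where
  m+1<k : suc m < k
  m+1<k = subst (_≤ k) (+-comm m 2) m+2≤k
  k<n : k < n
  k<n = subst (_≤ n) (+-comm k 1) (m≤o∸n⇒m+n≤o k (≤-trans (s≤s z≤n) 3≤n) k≤n-1)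

module _ {n m k : ℕ} (adm : Admissible n m k) where

  open Admissible adm

  private
    σ : ℕ → ℕ
    σ = transpose m

  NL-transpose : ∀ w → NL w ≡ k → NL (map σ w) ≡ k
  NL-transpose w NLw≡k = trans (NL-map σ w (transpose-fix-< m 0<m))
                               (trans (cong σ NLw≡k) (transpose-fix m k≢m k≢m+1))

  transpose-NT⊆A : ∀ {w} → NT n m k w → A n (suc m) k (map σ w)
  transpose-NT⊆A {[]} ((_ , 0≡m , _) , _) = contradiction 0≡m (<⇒≢ 0<m)
  transpose-NT⊆A {_ ∷ r} (((w↭ , dw) , refl , NLw≡k) , ¬tight) =
    (↭-trans (map-transpose-↭ m uw (here refl) sm∈w) w↭ , dσw) , transpose-m m , NL-transpose (m ∷ r) NLw≡k
    where
    uw : Unique (m ∷ r)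
    uw = IsPerm⇒Unique w↭
    sm∈w : suc m ∈ m ∷ r
    sm∈w = IsPerm⇒∈ w↭ (s≤s z≤n) (<⇒≤ m+2≤n)
    dσw : AndreI (map σ (m ∷ r))
    dσw = fromInj₁ (λ tight → contradiction (m , tight) ¬tight) (AndreI-transpose⊎TightAt m dw refl sm∈w uw)

  transpose-A⊆NT : ∀ {u} → A n (suc m) k u → NT n m k (map σ u)
  transpose-A⊆NT {[]} (_ , () , _)
  transpose-A⊆NT {_ ∷ r} ((u↭ , du) , refl , NLu≡k) =
    ((σu↭ , AndreI-transpose-F≡suc m du refl m∈u uu) , transpose-suc m , NL-transpose u NLu≡k) , ¬tight
    where
    u : Word
    u = suc m ∷ r
    uu : Unique u
    uu = IsPerm⇒Unique u↭
    m∈u : m ∈ u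
    m∈u = IsPerm⇒∈ u↭ 0<m (≤-trans (n≤1+n m) (<⇒≤ m+2≤n))
    σu↭ : IsPerm n (map σ u)
    σu↭ = ↭-trans (map-transpose-↭ m uu m∈u (here refl)) u↭
    n∈σu : n ∈ map σ u
    n∈σu = IsPerm⇒∈ σu↭ (≤-trans (s≤s z≤n) m+2≤n) ≤-refl
    ¬tight : ¬ Tight (map σ u)
    ¬tight (m' , t@(_ , _ , eq , _)) with trans (sym (∷-injectiveˡ eq)) (transpose-suc m)
    ... | refl with TightAt⇒bounded⊎¬AndreI-transpose m t
    ...   | inj₁ σu≤sm = <⇒≱ m+2≤n (All.lookup σu≤sm n∈σu)
    ...   | inj₂ ¬dσσu = ¬dσσu (subst AndreI (sym (map-transpose-involutive m u)) du)

proposition6p2 : (n m k : ℕ) → 3 ≤ n →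
    ((2 ≤ k + 1 × k + 1 ≤ m × m ≤ n ∸ 2) ⊎ (3 ≤ m + 2 × m + 2 ≤ k × k ≤ n ∸ 1)) →
    ((w : Word) → NT n m k w → A n (suc m) k (f w))
    × ((w₁ w₂ : Word) → NT n m k w₁ → NT n m k w₂ → f w₁ ≡ f w₂ → w₁ ≡ w₂)
    × ((u : Word) → A n (suc m) k u → ∃[ w ] (NT n m k w × f w ≡ u))
proposition6p2 n m k 3≤n range = maps-into , injective , onto
  where
  adm : Admissible n m k
  adm = admissible n m k 3≤n range
  maps-into : (w : Word) → NT n m k w → A n (suc m) k (f w)
  maps-into w w∈NT = subst (A n (suc m) k) (sym (NT⇒f≡transpose w∈NT)) (transpose-NT⊆A adm w∈NT)
  injective : (w₁ w₂ : Word) → NT n m k w₁ → NT n m k w₂ → f w₁ ≡ f w₂ → w₁ ≡ w₂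
  injective w₁ w₂ w₁∈NT w₂∈NT fw₁≡fw₂ = map-transpose-injective m
    (trans (sym (NT⇒f≡transpose w₁∈NT)) (trans fw₁≡fw₂ (NT⇒f≡transpose w₂∈NT)))
  onto : (u : Word) → A n (suc m) k u → ∃[ w ] (NT n m k w × f w ≡ u)
  onto u u∈A = map (transpose m) u , σu∈NT , trans (NT⇒f≡transpose σu∈NT) (map-transpose-involutive m u)
    where
    σu∈NT : NT n m k (map (transpose m) u)
    σu∈NT = transpose-A⊆NT adm u∈A
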